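{- For functions $f:\underline{X}\to\underline{Y}$ and $g:\underline{U}\to\underline{V}$ between topological spaces, $f\leq_2 g$ implies $\operatorname{bas}(f)\leq\operatorname{bas}(g)$.
   Context: A partial function $F:\subseteq X\to Y$ is continuous if continuous on $\operatorname{dom}(F)$ with the subspace topology. $f\leq_2 g$ means there are continuous partial functions $F:\subseteq\underline{X}\times\underline{V}\to\underline{Y}$ and $G:\subseteq\underline{X}\to\underline{U}$ with $f(x)=F(x,g(G(x)))$ (all defined) for all $x\in X$. A partition for a function $f:\underline{X}\to\underline{Y}$ is a partition $p$ of $X$ such that $f|_U$ is continuous (subspace topology) for every $U\in p$. The Basesize $\operatorname{bas}(f)$ is the least cardinality of a partition for $f$. -}

module Defs where

open import Data.Product using (Σ; Σ-syntax; ∃; _×_; _,_; proj₁; proj₂)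
open import Data.Unit using (⊤)
open import Relation.Binary.PropositionalEquality using (_≡_)
open import Function.Bundles using (_⇔_)

Subset : Set → Set₁
Subset X = X → Set

-- Topological space: carrier with a family of open sets, containing the
-- whole space, closed under binary intersections and arbitrary (Set-indexed)
-- unions, and invariant under extensional equality of subsets.
-- (The empty set is open as the empty union.)
record Space : Set₂ where
  field
    Carrier   : Set
    Open      : Subset Carrier → Set₁
    open-ext  : ∀ {A B : Subset Carrier} → (∀ x → A x ⇔ B x) → Open A → Open B
    open-univ : Open (λ _ → ⊤)
    open-∩    : ∀ {A B} → Open A → Open B → Open (λ x → A x × B x)
    open-⋃    : ∀ {I : Set} (A : I → Subset Carrier) → (∀ i → Open (A i)) →
                Open (λ x → Σ[ i ∈ I ] A i x)

open Space public

-- Subspace topology on a subset D of a space S (carrier Σ (Carrier S) D):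
-- open sets are exactly the traces of open sets of S.
-- (Its axioms are provable; we build the topology directly.)
module _ (S : Space) (D : Subset (Carrier S)) where
  SubOpen : Subset (Σ (Carrier S) D) → Set₁
  SubOpen O = Σ[ W ∈ Subset (Carrier S) ] (Open S W × (∀ p → O p ⇔ W (proj₁ p)))

-- A partial function F :⊆ X → Y is given by its domain dom ⊆ X together with
-- a total function on dom.
record Partial (X Y : Set) : Set₁ where
  field
    dom : Subset X
    app : Σ X dom → Y

open Partial public

ContinuousOn : (S : Space) (D : Subset (Carrier S)) (T : Space) →
               (Σ (Carrier S) D → Carrier T) → Set₁
ContinuousOn S D T h =
  ∀ (B : Subset (Carrier T)) → Open T B → SubOpen S D (λ p → B (h p))

ContinuousPartial : (S T : Space) → Partial (Carrier S) (Carrier T) → Set₁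
ContinuousPartial S T F = ContinuousOn S (dom F) T (app F)

-- Product topology: O is open iff every point of O lies in an open
-- rectangle contained in O.
_⊗_ : Space → Space → Space
S ⊗ T = record
  { Carrier   = Carrier S × Carrier T
  ; Open      = ProdOpen
  ; open-ext  = λ {A} {B} e o → λ p bp →
      let (U , V , oU , oV , u , v , sub) = o p (Equivalence.from (e p) bp)
      in U , V , oU , oV , u , v , λ q uq vq → Equivalence.to (e q) (sub q uq vq)
  ; open-univ = λ p _ → (λ _ → ⊤) , (λ _ → ⊤) , open-univ S , open-univ T , _ , _ , λ _ _ _ → _
  ; open-∩    = λ {A} {B} oA oB p (ap , bp) →
      let (U₁ , V₁ , oU₁ , oV₁ , u₁ , v₁ , s₁) = oA p ap
          (U₂ , V₂ , oU₂ , oV₂ , u₂ , v₂ , s₂) = oB p bp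
      in (λ x → U₁ x × U₂ x) , (λ y → V₁ y × V₂ y) , open-∩ S oU₁ oU₂ , open-∩ T oV₁ oV₂
         , (u₁ , u₂) , (v₁ , v₂) , λ q uq vq → s₁ q (proj₁ uq) (proj₁ vq) , s₂ q (proj₂ uq) (proj₂ vq)
  ; open-⋃    = λ A oA p (i , ap) →
      let (U , V , oU , oV , u , v , sub) = oA i p ap
      in U , V , oU , oV , u , v , λ q uq vq → i , sub q uq vq
  }
  where
  open import Function.Bundles using (module Equivalence)
  ProdOpen : Subset (Carrier S × Carrier T) → Set₁
  ProdOpen O = ∀ p → O p →
    Σ[ U ∈ Subset (Carrier S) ] Σ[ V ∈ Subset (Carrier T) ]
      (Open S U × Open T V × U (proj₁ p) × V (proj₂ p) ×
       (∀ q → U (proj₁ q) → V (proj₂ q) → O q))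

-- f ≤₂ g (f : X → Y, g : U → V arbitrary functions between the carriers):
-- there are continuous partial F :⊆ X × V → Y and G :⊆ X → U with
-- f x = F (x , g (G x)), all terms defined, for all x ∈ X.
_≤₂_ : {X Y U V : Space} → (Carrier X → Carrier Y) → (Carrier U → Carrier V) → Set₁
_≤₂_ {X} {Y} {U} {V} f g =
  Σ[ F ∈ Partial (Carrier X × Carrier V) (Carrier Y) ]
  Σ[ G ∈ Partial (Carrier X) (Carrier U) ]
    (ContinuousPartial (X ⊗ V) Y F × ContinuousPartial X U G ×
     Σ[ dG ∈ (∀ x → dom G x) ]
     Σ[ dF ∈ (∀ x → dom F (x , g (app G (x , dG x)))) ]
       (∀ x → f x ≡ app F ((x , g (app G (x , dG x))) , dF x)))

-- A partition of the carrier of X is represented by a labelling c : X → I;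
-- its pieces are the fibres c⁻¹(i).
IsPartitionFor : {X Y : Space} (f : Carrier X → Carrier Y) {I : Set} →
                 (Carrier X → I) → Set₁
IsPartitionFor {X} {Y} f c = ∀ i → ContinuousOn X (λ x → c x ≡ i) Y (λ p → f (proj₁ p))

-- Pieces of a partition are nonempty: the labelling is surjective.
-- Then the partition has exactly the cardinality of I.
Surjective : {A B : Set} → (A → B) → Set
Surjective {A} {B} c = ∀ b → Σ[ a ∈ A ] c a ≡ b

-- bas(f) ≤ |I|: f has a partition with at most |I| pieces, i.e. a labelling
-- into I (empty fibres are discarded, the nonempty ones inject into I).
BasLeCard : {X Y : Space} (f : Carrier X → Carrier Y) (I : Set) → Set₁
BasLeCard {X} {Y} f I = Σ[ d ∈ (Carrier X → I) ] IsPartitionFor {X} {Y} f d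

-- bas(f) ≤ bas(g): for every partition for g (of cardinality |I|),
-- f has a partition of cardinality ≤ |I|.
BasLe : {X Y U V : Space} → (Carrier X → Carrier Y) → (Carrier U → Carrier V) → Set₁
BasLe {X} {Y} {U} {V} f g =
  ∀ (I : Set) (c : Carrier U → I) → Surjective c → IsPartitionFor {U} {V} g c →
    BasLeCard {X} {Y} f I

module Submission where

-- Write f x = F (x , g (G x)) with F, G continuous partial maps. Given
-- a partition of U for g with labelling c, label x ∈ X by c (G x). On the
-- piece P = {x | c (G x) ≡ i}, f is the composite
--     x ↦ G x ↦ g (G x) ↦ (x , g (G x)) ↦ F (x , g (G x)),
-- each stage continuous on the relevant subspace: G restricted to P lands in
-- the piece c⁻¹(i) on which g is continuous, pairing with the identity is
-- continuous into the product, and F is continuous on its domain.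

open import Defs
open import Data.Product using (Σ; Σ-syntax; _×_; _,_; proj₁; proj₂)
open import Relation.Binary.PropositionalEquality using (_≡_; subst; sym)
open import Function.Bundles using (_⇔_; mk⇔; module Equivalence)
open import Function.Construct.Composition using (_⇔-∘_)

open Equivalence using (to; from)

continuous-cong : ∀ {S T : Space} {D : Subset (Carrier S)}
  {h h′ : Σ (Carrier S) D → Carrier T} →
  (∀ p → h p ≡ h′ p) → ContinuousOn S D T h → ContinuousOn S D T h′
continuous-cong h≡h′ cont B oB =
  let (W , oW , traceW) = cont B oB
  in W , oW , λ p → traceW p ⇔-∘ mk⇔ (subst B (sym (h≡h′ p))) (subst B (h≡h′ p))

continuous-restrict : ∀ {S T : Space} {D D′ : Subset (Carrier S)}
  {h : Σ (Carrier S) D → Carrier T} (D′⊆D : ∀ x → D′ x → D x) →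
  ContinuousOn S D T h →
  ContinuousOn S D′ T (λ p → h (proj₁ p , D′⊆D (proj₁ p) (proj₂ p)))
continuous-restrict D′⊆D cont B oB =
  let (W , oW , traceW) = cont B oB
  in W , oW , λ (x , d′) → traceW (x , D′⊆D x d′)

-- The preimage of B under
-- k ∘ h is the trace of the preimage (under h) of the open set cutting out
-- k⁻¹(B) in E.
continuous-∘ : ∀ {S T R : Space} {D : Subset (Carrier S)} {E : Subset (Carrier T)}
  {h : Σ (Carrier S) D → Carrier T} {k : Σ (Carrier T) E → Carrier R}
  (h∈E : ∀ p → E (h p)) →
  ContinuousOn S D T h → ContinuousOn T E R k →
  ContinuousOn S D R (λ p → k (h p , h∈E p))
continuous-∘ {h = h} h∈E cont-h cont-k B oB =
  let (W , oW , traceW) = cont-k B oB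
      (W′ , oW′ , traceW′) = cont-h W oW
  in W′ , oW′ , λ p → traceW′ p ⇔-∘ traceW (h p , h∈E p)

-- For an open O of the
-- product, take the union, over all points q of O, of Uq ∩ h⁻¹(Vq) where
-- Uq × Vq is an open rectangle around q inside O.
continuous-pair : ∀ {S T : Space} {D : Subset (Carrier S)}
  {h : Σ (Carrier S) D → Carrier T} →
  ContinuousOn S D T h →
  ContinuousOn S D (S ⊗ T) (λ p → proj₁ p , h p)
continuous-pair {S} {T} {D} {h} cont O oO =
  W , open-⋃ S cell (λ q → open-∩ S (open-fst q) (proj₁ (proj₂ (preimage q))))
    , λ p → mk⇔ (into p) (outof p)
  where
  Points : Set
  Points = Σ (Carrier S × Carrier T) O
  -- the open rectangle fst q × snd q around q inside O
  fst : Points → Subset (Carrier S)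
  fst (q , o) = proj₁ (oO q o)
  snd : Points → Subset (Carrier T)
  snd (q , o) = proj₁ (proj₂ (oO q o))
  open-fst : ∀ q → Open S (fst q)
  open-fst (q , o) = let (_ , _ , oU , _) = oO q o in oU
  open-snd : ∀ q → Open T (snd q)
  open-snd (q , o) = let (_ , _ , _ , oV , _) = oO q o in oV
  rectangle⊆O : ∀ q r → fst q (proj₁ r) → snd q (proj₂ r) → O r
  rectangle⊆O (q , o) = let (_ , _ , _ , _ , _ , _ , sub) = oO q o in sub
  preimage : (q : Points) → SubOpen S D (λ p → snd q (h p))
  preimage q = cont (snd q) (open-snd q)
  cell : Points → Subset (Carrier S)
  cell q x = fst q x × proj₁ (preimage q) x
  W : Subset (Carrier S)
  W x = Σ[ q ∈ Points ] cell q x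
  into : ∀ p → O (proj₁ p , h p) → W (proj₁ p)
  into p o =
    let (_ , _ , _ , _ , u , v , _) = oO (proj₁ p , h p) o
        q = ((proj₁ p , h p) , o)
    in q , u , to (proj₂ (proj₂ (preimage q)) p) v
  outof : ∀ p → W (proj₁ p) → O (proj₁ p , h p)
  outof p (q , u , t) =
    rectangle⊆O q (proj₁ p , h p) u (from (proj₂ (proj₂ (preimage q)) p) t)

-- The labelling c ∘ G yields a
-- partition for f of no larger cardinality.
theorem5p9 : {X Y U V : Space} (f : Carrier X → Carrier Y) (g : Carrier U → Carrier V) →
    _≤₂_ {X} {Y} {U} {V} f g → BasLe {X} {Y} {U} {V} f g
theorem5p9 {X} {Y} {U} {V} f g (F , G , cont-F , cont-G , dG , dF , f≡F) I c _ part-g =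
  (λ x → c (G′ x)) , piece-continuous
  where
  G′ : Carrier X → Carrier U
  G′ x = app G (x , dG x)
  piece-continuous : IsPartitionFor {X} {Y} f (λ x → c (G′ x))
  piece-continuous i = continuous-cong {X} {Y} (λ p → sym (f≡F (proj₁ p))) F∘pair
    where
    Piece : Subset (Carrier X)
    Piece x = c (G′ x) ≡ i
    G-on-piece : ContinuousOn X Piece U (λ p → G′ (proj₁ p))
    G-on-piece = continuous-restrict {X} {U} (λ x _ → dG x) cont-G
    g∘G-on-piece : ContinuousOn X Piece V (λ p → g (G′ (proj₁ p)))
    g∘G-on-piece = continuous-∘ {X} {U} {V} {E = λ u → c u ≡ i} proj₂ G-on-piece (part-g i)
    pair : ContinuousOn X Piece (X ⊗ V) (λ p → proj₁ p , g (G′ (proj₁ p)))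
    pair = continuous-pair {X} {V} g∘G-on-piece
    F∘pair : ContinuousOn X Piece Y (λ p → app F ((proj₁ p , g (G′ (proj₁ p))) , dF (proj₁ p)))
    F∘pair = continuous-∘ {X} {X ⊗ V} {Y} (λ p → dF (proj₁ p)) pair cont-F
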